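{- Let $(a_n)_{n\ge1}$ be a sequence of positive integers and let $l\ge0$, $r\ge1$ be integers with $a_n=a_{n+r}$ for all $n>l$. Let $s=a_{l+1}+\cdots+a_{l+r}$ and $D=B_{l+1}^{l+r-1}$. For each integer $k\ge0$ with $rk+l\ge1$, let $x_0$ and $x_{rk+l}$ be integers with $2^{sk+b_l}x_{rk+l}-3^{rk+l}x_0=B_{rk+l}$, $1\le x_0<2^{sk+b_l}$ and $1\le x_{rk+l}<3^{rk+l}$. Then there is a constant $K\in\mathbb N$, depending on $a_1,\dots,a_{l+r}$, such that for all $k>K$: (i) if $2^s>3^r$, there is $u_{rk+l}\in\mathbb Z$ with $0\le u_{rk+l}<(2^s-3^r)3^l$ such that $$x_0=\frac{2^{sk+b_l}u_{rk+l}-B_l(2^s-3^r)+2^{b_l}D}{(2^s-3^r)3^l},\qquad x_{rk+l}=\frac{3^{rk}u_{rk+l}+D}{2^s-3^r};$$ (ii) if $3^r>2^s$, there is $u_{rk+l}\in\mathbb N$ with $1\le u_{rk+l}\le(3^r-2^s)3^l$ such that $$x_0=\frac{2^{sk+b_l}u_{rk+l}-B_l(3^r-2^s)-2^{b_l}D}{(3^r-2^s)3^l},\qquad x_{rk+l}=\frac{3^{rk}u_{rk+l}-D}{3^r-2^s}.$$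
   Context: $b_0=0$, $b_n=\sum_{i=1}^n a_i$, $B_n=\sum_{i=0}^{n-1}3^{n-1-i}2^{b_i}$ (so $B_0=0$). For $u\ge1$, $v\ge u-1$: $b_u^v=\sum_{i=u}^va_i$ and $B_u^v=\sum_{j=u-1}^{v}3^{v-j}2^{b_u^j}$; thus $D=\sum_{j=l}^{l+r-1}3^{l+r-1-j}2^{b_{l+1}^j}$. Note $b_{rk+l}=sk+b_l$. -}

module Defs where

open import Data.Nat using (ℕ; zero; suc; _+_; _*_; _∸_; _^_)

∑ : ℕ → (ℕ → ℕ) → ℕ
∑ zero    f = 0
∑ (suc n) f = ∑ n f + f n

-- b_u^v = a_u + ... + a_v   (for v ≥ u - 1; empty sum when v = u - 1)
bseg : (ℕ → ℕ) → ℕ → ℕ → ℕ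
bseg a u v = ∑ (suc v ∸ u) (λ i → a (u + i))

b : (ℕ → ℕ) → ℕ → ℕ
b a n = ∑ n (λ i → a (suc i))

B : (ℕ → ℕ) → ℕ → ℕ
B a n = ∑ n (λ i → 3 ^ (n ∸ 1 ∸ i) * 2 ^ b a i)

-- B_u^v = ∑_{j=u-1}^{v} 3^{v-j} 2^{b_u^j}
Bseg : (ℕ → ℕ) → ℕ → ℕ → ℕ
Bseg a u v = ∑ (suc v ∸ (u ∸ 1)) (λ t → 3 ^ (v ∸ (u ∸ 1 + t)) * 2 ^ bseg a u (u ∸ 1 + t))

sPer : (ℕ → ℕ) → ℕ → ℕ → ℕ
sPer a l r = bseg a (suc l) (l + r)

Dconst : (ℕ → ℕ) → ℕ → ℕ → ℕ
Dconst a l r = Bseg a (suc l) (l + r ∸ 1)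

-- Write E t = ∑_{i<t} 3^{t-1-i} 2^{a_{l+1} + … + a_{l+i}}, a base-3 Horner sum, so D = E r.
--  * Horner bookkeeping gives B_{l+t} = 3^t B_l + 2^{b_l} E t and, by periodicity,
--    E (r + t) = 3^t E r + 2^s E t.  Splitting E (r(k+1)) in two ways yields the
--    geometric identity 2^s E(rk) + 3^{rk} D = 3^r E(rk) + 2^{sk} D.
--  * Multiplying the equation by d = |2^s - 3^r| and using that identity gives
--    2^{sk+b_l} (d x_n ∓ D) = 3^{rk} (3^l d x_0 + B_l d ∓ 2^{b_l} D), stated in ℕ.
--  * As 3^{rk} and 2^{sk+b_l} are coprime, d x_n ∓ D = u 3^{rk}; the box constraints and
--    2^{sk} > B_l 3^r + D (true once k > K = B_l 3^r + D) fix the range of u.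

module Submission where

open import Defs
open import Data.Nat using (ℕ; zero; suc; _+_; _*_; _∸_; _^_; _≤_; _<_; _>_; s≤s; z≤n; NonZero; >-nonZero; s≤s⁻¹)
open import Data.Nat.Properties
open import Data.Nat.Coprimality as Coprimality using (Coprime; coprime-divisor; gcd≡1⇒coprime)
open import Data.Nat.Divisibility using (_∣_; divides; ∣-trans; ∣1⇒≡1; ∣m+n∣m⇒∣n; m∣m*n)
import Data.Nat.Tactic.RingSolver as ℕ-Solver
open import Data.Integer using (ℤ; +_; +≤+; +<+) renaming (_+_ to _+ℤ_; _-_ to _-ℤ_; _*_ to _*ℤ_; _≤_ to _≤ℤ_; _<_ to _<ℤ_)
open import Data.Integer.Properties using (pos-+; pos-*; [+m]-[+n]≡m⊖n; ⊖-≥) renaming (+-injective to pos-injective)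
import Data.Integer.Tactic.RingSolver as ℤ-Solver
open import Data.Product using (_×_; _,_; ∃)
open import Data.Sum using (inj₁; inj₂)
open import Relation.Nullary using (contradiction)
open import Relation.Binary.PropositionalEquality

∑-split : ∀ m n f → ∑ (m + n) f ≡ ∑ m f + ∑ n (λ i → f (m + i))
∑-split m zero    f = trans (cong (λ k → ∑ k f) (+-identityʳ m)) (sym (+-identityʳ _))
∑-split m (suc n) f = begin
  ∑ (m + suc n) f                                   ≡⟨ cong (λ k → ∑ k f) (+-suc m n) ⟩
  ∑ (m + n) f + f (m + n)                           ≡⟨ cong (_+ f (m + n)) (∑-split m n f) ⟩
  ∑ m f + ∑ n (λ i → f (m + i)) + f (m + n)         ≡⟨ +-assoc (∑ m f) _ _ ⟩
  ∑ m f + ∑ (suc n) (λ i → f (m + i))               ∎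
  where open ≡-Reasoning

∑-cong : ∀ n {f g : ℕ → ℕ} → (∀ i → i < n → f i ≡ g i) → ∑ n f ≡ ∑ n g
∑-cong zero    f≗g = refl
∑-cong (suc n) f≗g = cong₂ _+_ (∑-cong n (λ i i<n → f≗g i (m<n⇒m<1+n i<n))) (f≗g n ≤-refl)

∑-scale : ∀ n k f → ∑ n (λ i → k * f i) ≡ k * ∑ n f
∑-scale zero    k f = sym (*-zeroʳ k)
∑-scale (suc n) k f = trans (cong (_+ k * f n) (∑-scale n k f)) (sym (*-distribˡ-+ k (∑ n f) (f n)))

horner : (ℕ → ℕ) → ℕ → ℕ
horner g n = ∑ n (λ i → 3 ^ (n ∸ 1 ∸ i) * g i)

horner-step : ∀ g n → horner g (suc n) ≡ 3 * horner g n + g n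
horner-step g n = cong₂ _+_ earlier-terms last-term
  where
  exponent : ∀ {n i} → i < n → n ∸ i ≡ suc (n ∸ 1 ∸ i)
  exponent {suc n} (s≤s i≤n) = +-∸-assoc 1 i≤n
  earlier-terms : ∑ n (λ i → 3 ^ (n ∸ i) * g i) ≡ 3 * horner g n
  earlier-terms = trans (∑-cong n one-more-power) (∑-scale n 3 (λ i → 3 ^ (n ∸ 1 ∸ i) * g i))
    where
    one-more-power : ∀ i → i < n → 3 ^ (n ∸ i) * g i ≡ 3 * (3 ^ (n ∸ 1 ∸ i) * g i)
    one-more-power i i<n = begin
      3 ^ (n ∸ i) * g i              ≡⟨ cong (λ e → 3 ^ e * g i) (exponent i<n) ⟩
      3 ^ suc (n ∸ 1 ∸ i) * g i      ≡⟨ *-assoc 3 (3 ^ (n ∸ 1 ∸ i)) (g i) ⟩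
      3 * (3 ^ (n ∸ 1 ∸ i) * g i)    ∎
      where open ≡-Reasoning
  last-term : 3 ^ (n ∸ n) * g n ≡ g n
  last-term = trans (cong (λ e → 3 ^ e * g n) (n∸n≡0 n)) (*-identityˡ (g n))

horner-cong : ∀ n {f g : ℕ → ℕ} → (∀ i → f i ≡ g i) → horner f n ≡ horner g n
horner-cong n f≗g = ∑-cong n (λ i _ → cong (3 ^ (n ∸ 1 ∸ i) *_) (f≗g i))

horner-scale : ∀ k g n → horner (λ i → k * g i) n ≡ k * horner g n
horner-scale k g zero    = sym (*-zeroʳ k)
horner-scale k g (suc n) = begin
  horner (λ i → k * g i) (suc n)         ≡⟨ horner-step (λ i → k * g i) n ⟩
  3 * horner (λ i → k * g i) n + k * g n ≡⟨ cong (λ h → 3 * h + k * g n) (horner-scale k g n) ⟩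
  3 * (k * horner g n) + k * g n         ≡⟨ regroup k (horner g n) (g n) ⟩
  k * (3 * horner g n + g n)             ≡⟨ cong (k *_) (sym (horner-step g n)) ⟩
  k * horner g (suc n)                   ∎
  where
  open ≡-Reasoning
  regroup : ∀ k h x → 3 * (k * h) + k * x ≡ k * (3 * h + x)
  regroup = ℕ-Solver.solve-∀

horner-shift : ∀ g m t → horner g (m + t) ≡ 3 ^ t * horner g m + horner (λ i → g (m + i)) t
horner-shift g m zero    = begin
  horner g (m + 0)         ≡⟨ cong (horner g) (+-identityʳ m) ⟩
  horner g m               ≡⟨ sym (+-identityʳ _) ⟩
  horner g m + 0           ≡⟨ cong (_+ 0) (sym (*-identityˡ _)) ⟩
  1 * horner g m + 0       ∎
  where open ≡-Reasoning
horner-shift g m (suc t) = begin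
  horner g (m + suc t)                        ≡⟨ cong (horner g) (+-suc m t) ⟩
  horner g (suc (m + t))                      ≡⟨ horner-step g (m + t) ⟩
  3 * horner g (m + t) + g (m + t)            ≡⟨ cong (λ h → 3 * h + g (m + t)) (horner-shift g m t) ⟩
  3 * (3 ^ t * H + H′) + g (m + t)            ≡⟨ regroup (3 ^ t) H H′ (g (m + t)) ⟩
  3 * 3 ^ t * H + (3 * H′ + g (m + t))        ≡⟨ cong (λ x → 3 * 3 ^ t * H + x) (sym (horner-step g′ t)) ⟩
  3 ^ suc t * H + horner g′ (suc t)           ∎
  where
  open ≡-Reasoning
  g′ : ℕ → ℕ
  g′ i = g (m + i)
  H H′ : ℕ
  H  = horner g m
  H′ = horner g′ t
  regroup : ∀ p h h′ x → 3 * (p * h + h′) + x ≡ 3 * p * h + (3 * h′ + x)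
  regroup = ℕ-Solver.solve-∀

horner-exp-shift : ∀ (f g : ℕ → ℕ) m → (∀ i → f (m + i) ≡ f m + g i) →
  ∀ t → horner (λ i → 2 ^ f i) (m + t) ≡ 3 ^ t * horner (λ i → 2 ^ f i) m + 2 ^ f m * horner (λ i → 2 ^ g i) t
horner-exp-shift f g m additive t = begin
  horner (λ i → 2 ^ f i) (m + t)                                      ≡⟨ horner-shift (λ i → 2 ^ f i) m t ⟩
  3 ^ t * H + horner (λ i → 2 ^ f (m + i)) t                          ≡⟨ cong (λ x → 3 ^ t * H + x) (horner-cong t split-power) ⟩
  3 ^ t * H + horner (λ i → 2 ^ f m * 2 ^ g i) t                      ≡⟨ cong (λ x → 3 ^ t * H + x) (horner-scale (2 ^ f m) (λ i → 2 ^ g i) t) ⟩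
  3 ^ t * H + 2 ^ f m * horner (λ i → 2 ^ g i) t                      ∎
  where
  open ≡-Reasoning
  H : ℕ
  H = horner (λ i → 2 ^ f i) m
  split-power : ∀ i → 2 ^ f (m + i) ≡ 2 ^ f m * 2 ^ g i
  split-power i = trans (cong (2 ^_) (additive i)) (^-distribˡ-+-* 2 (f m) (g i))

-- A sequence with F 0 = 0 and F (k+1) = Y^k D + X F k also satisfies the mirrored
-- recurrence F (k+1) = X^k D + Y F k (formally F k = D (X^k - Y^k)/(X - Y)).
recurrence-symmetry : ∀ (X Y D : ℕ) (F : ℕ → ℕ) → F 0 ≡ 0 → (∀ k → F (suc k) ≡ Y ^ k * D + X * F k) →
  ∀ k → X * F k + Y ^ k * D ≡ Y * F k + X ^ k * D
recurrence-symmetry X Y D F F0 step zero rewrite F0 = cong (_+ 1 * D) (trans (*-zeroʳ X) (sym (*-zeroʳ Y)))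
recurrence-symmetry X Y D F F0 step (suc k) = begin
  X * F (suc k) + Y ^ suc k * D                ≡⟨ cong (λ f → X * f + Y ^ suc k * D) (step k) ⟩
  X * (Y ^ k * D + X * F k) + Y * Y ^ k * D    ≡⟨ regroup₁ X Y (Y ^ k) D (F k) ⟩
  X * (X * F k + Y ^ k * D) + Y * Y ^ k * D    ≡⟨ cong (λ e → X * e + Y * Y ^ k * D) (recurrence-symmetry X Y D F F0 step k) ⟩
  X * (Y * F k + X ^ k * D) + Y * Y ^ k * D    ≡⟨ regroup₂ X Y (X ^ k) (Y ^ k) D (F k) ⟩
  Y * (Y ^ k * D + X * F k) + X * X ^ k * D    ≡⟨ cong (λ f → Y * f + X ^ suc k * D) (sym (step k)) ⟩
  Y * F (suc k) + X ^ suc k * D                ∎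
  where
  open ≡-Reasoning
  regroup₁ : ∀ X Y p D f → X * (p * D + X * f) + Y * p * D ≡ X * (X * f + p * D) + Y * p * D
  regroup₁ = ℕ-Solver.solve-∀
  regroup₂ : ∀ X Y q p D f → X * (Y * f + q * D) + Y * p * D ≡ Y * (p * D + X * f) + X * q * D
  regroup₂ = ℕ-Solver.solve-∀

module Sequence (a : ℕ → ℕ) (l : ℕ) where

  c : ℕ → ℕ
  c t = ∑ t (λ i → a (suc l + i))

  E : ℕ → ℕ
  E = horner (λ i → 2 ^ c i)

  bseg≡c : ∀ t → bseg a (suc l) (l + t) ≡ c t
  bseg≡c t = cong (λ n → ∑ n (λ i → a (suc l + i))) (m+n∸m≡n l t)

  sPer≡c : ∀ r → sPer a l r ≡ c r
  sPer≡c = bseg≡c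

  Dconst≡E : ∀ r → 1 ≤ r → Dconst a l r ≡ E r
  Dconst≡E (suc r) _ rewrite +-suc l r = begin
    ∑ (suc (l + r) ∸ l) term                ≡⟨ cong (λ n → ∑ n term) (trans (sym (cong (_∸ l) (+-suc l r))) (m+n∸m≡n l (suc r))) ⟩
    ∑ (suc r) term                          ≡⟨ ∑-cong (suc r) (λ t _ → cong₂ (λ e f → 3 ^ e * 2 ^ f) ([m+n]∸[m+o]≡n∸o l r t) (bseg≡c t)) ⟩
    E (suc r)                               ∎
    where
    open ≡-Reasoning
    term : ℕ → ℕ
    term t = 3 ^ ((l + r) ∸ (l + t)) * 2 ^ bseg a (suc l) (l + t)

  -- b_{l+i} = b_l + c i, hence B_{l+t} = 3^t B_l + 2^{b_l} E t.
  B-shift : ∀ t → B a (l + t) ≡ 3 ^ t * B a l + 2 ^ b a l * E t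
  B-shift = horner-exp-shift (b a) c l (λ i → ∑-split l i (λ j → a (suc j)))

  c-positive : (∀ n → 1 ≤ n → 1 ≤ a n) → ∀ r → 1 ≤ r → 1 ≤ c r
  c-positive pos (suc r) _ = ≤-trans (pos (suc l + r) (s≤s z≤n)) (m≤n+m _ (c r))

  module Periodic (r : ℕ) (per : ∀ n → n > l → a n ≡ a (n + r)) where

    c-shift : ∀ i → c (r + i) ≡ c r + c i
    c-shift i = trans (∑-split r i (λ j → a (suc l + j))) (cong (λ x → c r + x) (∑-cong i shifted))
      where
      shifted : ∀ j → j < i → a (suc l + (r + j)) ≡ a (suc l + j)
      shifted j _ = sym (trans (per (suc l + j) (s≤s (m≤m+n l j)))
                               (cong a (trans (+-assoc (suc l) j r) (cong (λ x → suc l + x) (+-comm j r)))))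

    E-shift : ∀ t → E (r + t) ≡ 3 ^ t * E r + 2 ^ c r * E t
    E-shift = horner-exp-shift c c r c-shift

    -- Splitting E (r (k+1)) as r + r k and as r k + r gives the same value.
    E-geometric : ∀ k → 2 ^ c r * E (r * k) + 3 ^ (r * k) * E r ≡ 3 ^ r * E (r * k) + 2 ^ (c r * k) * E r
    E-geometric k = subst₂ (λ p q → 2 ^ c r * E (r * k) + p * E r ≡ 3 ^ r * E (r * k) + q * E r)
                      (^-*-assoc 3 r k) (^-*-assoc 2 (c r) k)
                      (recurrence-symmetry (2 ^ c r) (3 ^ r) (E r) (λ k → E (r * k)) (cong E (*-zeroʳ r)) step k)
      where
      step : ∀ k → E (r * suc k) ≡ (3 ^ r) ^ k * E r + 2 ^ c r * E (r * k)
      step k = begin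
        E (r * suc k)                            ≡⟨ cong E (*-suc r k) ⟩
        E (r + r * k)                            ≡⟨ E-shift (r * k) ⟩
        3 ^ (r * k) * E r + 2 ^ c r * E (r * k)  ≡⟨ cong (λ p → p * E r + 2 ^ c r * E (r * k)) (sym (^-*-assoc 3 r k)) ⟩
        (3 ^ r) ^ k * E r + 2 ^ c r * E (r * k)  ∎
        where open ≡-Reasoning

coprime-*ʳ : ∀ {m n o} → Coprime m n → Coprime m o → Coprime m (n * o)
coprime-*ʳ {n = n} m⊥n m⊥o {d} (d∣m , d∣no) = m⊥o (d∣m , coprime-divisor d⊥n d∣no)
  where
  d⊥n : Coprime d n
  d⊥n (e∣d , e∣n) = m⊥n (∣-trans e∣d d∣m , e∣n)

coprime-^ʳ : ∀ {m n} → Coprime m n → ∀ k → Coprime m (n ^ k)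
coprime-^ʳ m⊥n zero    (_ , d∣1) = ∣1⇒≡1 d∣1
coprime-^ʳ m⊥n (suc k) = coprime-*ʳ m⊥n (coprime-^ʳ m⊥n k)

coprime-3^-2^ : ∀ i j → Coprime (3 ^ i) (2 ^ j)
coprime-3^-2^ i j = Coprimality.sym (coprime-^ʳ (Coprimality.sym (coprime-^ʳ 3⊥2 j)) i)
  where
  3⊥2 : Coprime 3 2
  3⊥2 = gcd≡1⇒coprime refl

coprime-quotient : ∀ {Q W e c R} .{{_ : NonZero Q}} → Coprime Q W → W * e + Q * c ≡ Q * R →
  ∃ λ u → e ≡ u * Q × W * u + c ≡ R
coprime-quotient {Q} {W} {e} {c} {R} Q⊥W eq = cofactor (coprime-divisor Q⊥W Q∣We)
  where
  Q∣We : Q ∣ W * e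
  Q∣We = ∣m+n∣m⇒∣n (subst (Q ∣_) (trans (sym eq) (+-comm (W * e) (Q * c))) (m∣m*n R)) (m∣m*n c)
  cofactor : Q ∣ e → ∃ λ u → e ≡ u * Q × W * u + c ≡ R
  cofactor (divides u e≡uQ) = u , e≡uQ , *-cancelˡ-≡ (W * u + c) R Q (begin
    Q * (W * u + c)      ≡⟨ regroup Q W u c ⟩
    W * (u * Q) + Q * c  ≡⟨ cong (λ x → W * x + Q * c) (sym e≡uQ) ⟩
    W * e + Q * c        ≡⟨ eq ⟩
    Q * R                ∎)
    where
    open ≡-Reasoning
    regroup : ∀ Q W u c → Q * (W * u + c) ≡ W * (u * Q) + Q * c
    regroup = ℕ-Solver.solve-∀

-- The shifted version: W a + Q c = Q R + W b with c < W forces a = u Q + b for a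
-- natural u; the alternative a < b would give c = R + W v with v ≥ 1, so c ≥ W.
coprime-quotient-shifted : ∀ {Q W a b c R} .{{_ : NonZero Q}} → Coprime Q W → c < W →
  W * a + Q * c ≡ Q * R + W * b → ∃ λ u → a ≡ u * Q + b × W * u + c ≡ R
coprime-quotient-shifted {Q} {W} {a} {b} {c} {R} Q⊥W c<W eq with ≤-<-connex b a
... | inj₁ b≤a = shift-back (coprime-quotient Q⊥W excess)
  where
  e : ℕ
  e = a ∸ b
  b+e≡a : b + e ≡ a
  b+e≡a = m+[n∸m]≡n b≤a
  excess : W * e + Q * c ≡ Q * R
  excess = +-cancelˡ-≡ (W * b) _ _ (begin
    W * b + (W * e + Q * c)  ≡⟨ regroup W b e (Q * c) ⟩
    W * (b + e) + Q * c      ≡⟨ cong (λ x → W * x + Q * c) b+e≡a ⟩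
    W * a + Q * c            ≡⟨ eq ⟩
    Q * R + W * b            ≡⟨ +-comm (Q * R) (W * b) ⟩
    W * b + Q * R            ∎)
    where
    open ≡-Reasoning
    regroup : ∀ W b e x → W * b + (W * e + x) ≡ W * (b + e) + x
    regroup = ℕ-Solver.solve-∀
  shift-back : (∃ λ u → e ≡ u * Q × W * u + c ≡ R) → ∃ λ u → a ≡ u * Q + b × W * u + c ≡ R
  shift-back (u , e≡uQ , Wu+c≡R) = u , trans (sym b+e≡a) (trans (+-comm b e) (cong (_+ b) e≡uQ)) , Wu+c≡R
... | inj₂ a<b = contradiction c<W (≤⇒≯ (deficit (coprime-quotient Q⊥W deficit-eq)))
  where
  e : ℕ
  e = b ∸ suc a
  a+1+e≡b : suc a + e ≡ b
  a+1+e≡b = m+[n∸m]≡n a<b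
  deficit-eq : W * suc e + Q * R ≡ Q * c
  deficit-eq = +-cancelˡ-≡ (W * a) _ _ (begin
    W * a + (W * suc e + Q * R)  ≡⟨ regroup W a e (Q * R) ⟩
    Q * R + W * (suc a + e)      ≡⟨ cong (λ x → Q * R + W * x) a+1+e≡b ⟩
    Q * R + W * b                ≡⟨ sym eq ⟩
    W * a + Q * c                ∎)
    where
    open ≡-Reasoning
    regroup : ∀ W a e x → W * a + (W * (1 + e) + x) ≡ x + W * (1 + a + e)
    regroup = ℕ-Solver.solve-∀
  deficit : (∃ λ v → suc e ≡ v * Q × W * v + R ≡ c) → W ≤ c
  deficit (zero  , () , _)
  deficit (suc v , _ , Wv+R≡c) = begin
    W             ≤⟨ m≤m*n W (suc v) ⟩
    W * suc v     ≤⟨ m≤m+n (W * suc v) R ⟩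
    W * suc v + R ≡⟨ Wv+R≡c ⟩
    c             ∎
    where open ≤-Reasoning

from-ℤ : ∀ w x n y b → + w *ℤ + x -ℤ + n *ℤ + y ≡ + b → w * x ≡ n * y + b
from-ℤ w x n y b eq = pos-injective (begin
  + (w * x)                              ≡⟨ pos-* w x ⟩
  + w *ℤ + x                             ≡⟨ regroup (+ w *ℤ + x) (+ n *ℤ + y) ⟩
  (+ w *ℤ + x -ℤ + n *ℤ + y) +ℤ + n *ℤ + y ≡⟨ cong₂ _+ℤ_ eq (sym (pos-* n y)) ⟩
  + b +ℤ + (n * y)                       ≡⟨ sym (pos-+ b (n * y)) ⟩
  + (b + n * y)                          ≡⟨ cong +_ (+-comm b (n * y)) ⟩
  + (n * y + b)                          ∎)
  where
  open ≡-Reasoning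
  regroup : ∀ p q → p ≡ p -ℤ q +ℤ q
  regroup = ℤ-Solver.solve-∀

ι-affine : ∀ a b c → + (a * b + c) ≡ + a *ℤ + b +ℤ + c
ι-affine a b c = trans (pos-+ (a * b) c) (cong (_+ℤ + c) (pos-* a b))

ι-sum : ∀ a b c e → + (a * b + c * e) ≡ + a *ℤ + b +ℤ + c *ℤ + e
ι-sum a b c e = trans (ι-affine a b (c * e)) (cong (+ a *ℤ + b +ℤ_) (pos-* c e))

ι-sum₃ : ∀ a b c e f → + (a * b * c + e * f) ≡ + a *ℤ + b *ℤ + c +ℤ + e *ℤ + f
ι-sum₃ a b c e f = trans (ι-sum (a * b) c e f) (cong (λ x → x *ℤ + c +ℤ + e *ℤ + f) (pos-* a b))

positive-difference : ∀ {m n} → n ≤ m → + m -ℤ + n ≡ + (m ∸ n)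
positive-difference {m} {n} n≤m = trans ([+m]-[+n]≡m⊖n m n) (⊖-≥ n≤m)

lift-above : ∀ W Q T D L Bl d m₀ mₙ →
  (∃ λ u → u < d * L × d * mₙ ≡ u * Q + D × W * u + T * D ≡ L * d * m₀ + Bl * d) →
  ∃ λ (u : ℤ) → + 0 ≤ℤ u × u <ℤ + d *ℤ + L
    × + m₀ *ℤ (+ d *ℤ + L) ≡ + W *ℤ u -ℤ + Bl *ℤ + d +ℤ + T *ℤ + D
    × + mₙ *ℤ + d ≡ + Q *ℤ u +ℤ + D
lift-above W Q T D L Bl d m₀ mₙ (u , u<dL , dmₙ≡uQ+D , Wu+TD≡R) =
  + u , +≤+ z≤n , subst (+ u <ℤ_) (pos-* d L) (+<+ u<dL) , x₀-equation , xₙ-equation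
  where
  open ≡-Reasoning
  x₀-equation : + m₀ *ℤ (+ d *ℤ + L) ≡ + W *ℤ + u -ℤ + Bl *ℤ + d +ℤ + T *ℤ + D
  x₀-equation = begin
    + m₀ *ℤ (+ d *ℤ + L)                              ≡⟨ regroup₁ (+ m₀) (+ d) (+ L) (+ Bl) ⟩
    + L *ℤ + d *ℤ + m₀ +ℤ + Bl *ℤ + d -ℤ + Bl *ℤ + d  ≡⟨ cong (_-ℤ + Bl *ℤ + d) (sym (ι-sum₃ L d m₀ Bl d)) ⟩
    + (L * d * m₀ + Bl * d) -ℤ + Bl *ℤ + d            ≡⟨ cong (λ x → + x -ℤ + Bl *ℤ + d) (sym Wu+TD≡R) ⟩
    + (W * u + T * D) -ℤ + Bl *ℤ + d                  ≡⟨ cong (_-ℤ + Bl *ℤ + d) (ι-sum W u T D) ⟩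
    + W *ℤ + u +ℤ + T *ℤ + D -ℤ + Bl *ℤ + d           ≡⟨ regroup₂ (+ W *ℤ + u) (+ T *ℤ + D) (+ Bl *ℤ + d) ⟩
    + W *ℤ + u -ℤ + Bl *ℤ + d +ℤ + T *ℤ + D           ∎
    where
    regroup₁ : ∀ m d L Bl → m *ℤ (d *ℤ L) ≡ L *ℤ d *ℤ m +ℤ Bl *ℤ d -ℤ Bl *ℤ d
    regroup₁ = ℤ-Solver.solve-∀
    regroup₂ : ∀ p q r → p +ℤ q -ℤ r ≡ p -ℤ r +ℤ q
    regroup₂ = ℤ-Solver.solve-∀
  xₙ-equation : + mₙ *ℤ + d ≡ + Q *ℤ + u +ℤ + D
  xₙ-equation = begin
    + mₙ *ℤ + d       ≡⟨ sym (pos-* mₙ d) ⟩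
    + (mₙ * d)        ≡⟨ cong +_ (trans (*-comm mₙ d) (trans dmₙ≡uQ+D (cong (_+ D) (*-comm u Q)))) ⟩
    + (Q * u + D)     ≡⟨ ι-affine Q u D ⟩
    + Q *ℤ + u +ℤ + D ∎

lift-below : ∀ W Q T D L Bl d m₀ mₙ →
  (∃ λ u → 1 ≤ u × u ≤ d * L × d * mₙ + D ≡ u * Q × W * u ≡ L * d * m₀ + Bl * d + T * D) →
  ∃ λ (u : ℤ) → + 1 ≤ℤ u × u ≤ℤ + d *ℤ + L
    × + m₀ *ℤ (+ d *ℤ + L) ≡ + W *ℤ u -ℤ + Bl *ℤ + d -ℤ + T *ℤ + D
    × + mₙ *ℤ + d ≡ + Q *ℤ u -ℤ + D
lift-below W Q T D L Bl d m₀ mₙ (u , 1≤u , u≤dL , dmₙ+D≡uQ , Wu≡R) =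
  + u , +≤+ 1≤u , subst (+ u ≤ℤ_) (pos-* d L) (+≤+ u≤dL) , x₀-equation , xₙ-equation
  where
  open ≡-Reasoning
  x₀-equation : + m₀ *ℤ (+ d *ℤ + L) ≡ + W *ℤ + u -ℤ + Bl *ℤ + d -ℤ + T *ℤ + D
  x₀-equation = begin
    + m₀ *ℤ (+ d *ℤ + L)                                                  ≡⟨ regroup (+ m₀) (+ d) (+ L) (+ Bl) (+ T *ℤ + D) ⟩
    + L *ℤ + d *ℤ + m₀ +ℤ + Bl *ℤ + d +ℤ + T *ℤ + D -ℤ + Bl *ℤ + d -ℤ + T *ℤ + D
                                                                          ≡⟨ cong (λ x → x -ℤ + Bl *ℤ + d -ℤ + T *ℤ + D) (sym R-cast) ⟩
    + (L * d * m₀ + Bl * d + T * D) -ℤ + Bl *ℤ + d -ℤ + T *ℤ + D          ≡⟨ cong (λ x → + x -ℤ + Bl *ℤ + d -ℤ + T *ℤ + D) (sym Wu≡R) ⟩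
    + (W * u) -ℤ + Bl *ℤ + d -ℤ + T *ℤ + D                                ≡⟨ cong (λ x → x -ℤ + Bl *ℤ + d -ℤ + T *ℤ + D) (pos-* W u) ⟩
    + W *ℤ + u -ℤ + Bl *ℤ + d -ℤ + T *ℤ + D                               ∎
    where
    R-cast : + (L * d * m₀ + Bl * d + T * D) ≡ + L *ℤ + d *ℤ + m₀ +ℤ + Bl *ℤ + d +ℤ + T *ℤ + D
    R-cast = trans (pos-+ (L * d * m₀ + Bl * d) (T * D)) (cong₂ _+ℤ_ (ι-sum₃ L d m₀ Bl d) (pos-* T D))
    regroup : ∀ m d L Bl t → m *ℤ (d *ℤ L) ≡ L *ℤ d *ℤ m +ℤ Bl *ℤ d +ℤ t -ℤ Bl *ℤ d -ℤ t
    regroup = ℤ-Solver.solve-∀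
  xₙ-equation : + mₙ *ℤ + d ≡ + Q *ℤ + u -ℤ + D
  xₙ-equation = begin
    + mₙ *ℤ + d               ≡⟨ regroup₁ (+ mₙ) (+ d) (+ D) ⟩
    + d *ℤ + mₙ +ℤ + D -ℤ + D ≡⟨ cong (_-ℤ + D) (sym (ι-affine d mₙ D)) ⟩
    + (d * mₙ + D) -ℤ + D     ≡⟨ cong (λ x → + x -ℤ + D) dmₙ+D≡uQ ⟩
    + (u * Q) -ℤ + D          ≡⟨ cong (_-ℤ + D) (pos-* u Q) ⟩
    + u *ℤ + Q -ℤ + D         ≡⟨ regroup₂ (+ u) (+ Q) (+ D) ⟩
    + Q *ℤ + u -ℤ + D         ∎
    where
    regroup₁ : ∀ m d D → m *ℤ d ≡ d *ℤ m +ℤ D -ℤ D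
    regroup₁ = ℤ-Solver.solve-∀
    regroup₂ : ∀ u Q D → u *ℤ Q -ℤ D ≡ Q *ℤ u -ℤ D
    regroup₂ = ℤ-Solver.solve-∀

-- In the
-- application W = 2^{sk+b_l} = P T, N = 3^{rk+l} = Q L, Bn = B_{rk+l} = Q B_l + T F,
-- X = 2^s, Y = 3^r, F = E(rk) and D is the constant of the theorem.
module Core (W N Bn P T Q L Bl D F X Y : ℕ)
  (W≡PT : W ≡ P * T) (N≡QL : N ≡ Q * L) (Bn≡QBl+TF : Bn ≡ Q * Bl + T * F)
  (geometric : X * F + Q * D ≡ Y * F + P * D)
  (Q⊥W : Coprime Q W) .{{_ : NonZero T}} .{{_ : NonZero Q}}
  (large : Bl * Y + D < P) where

  T[BlY+D]<W : T * (Bl * Y + D) < W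
  T[BlY+D]<W = subst (T * (Bl * Y + D) <_) (trans (*-comm T P) (sym W≡PT)) (*-monoʳ-< T large)

  remainder<W : ∀ {d} → d ≤ Y → Bl * d + T * D < W
  remainder<W {d} d≤Y = begin-strict
    Bl * d + T * D          ≤⟨ +-monoˡ-≤ (T * D) (*-monoʳ-≤ Bl d≤Y) ⟩
    Bl * Y + T * D          ≤⟨ +-monoˡ-≤ (T * D) (m≤n*m (Bl * Y) T) ⟩
    T * (Bl * Y) + T * D    ≡⟨ sym (*-distribˡ-+ T (Bl * Y) D) ⟩
    T * (Bl * Y + D)        <⟨ T[BlY+D]<W ⟩
    W                       ∎
    where open ≤-Reasoning

  module Solution (m₀ mₙ : ℕ) (equation : W * mₙ ≡ N * m₀ + Bn)
                  (m₀<W : m₀ < W) (1≤mₙ : 1 ≤ mₙ) (mₙ<N : mₙ < N) where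

    expanded : W * mₙ ≡ Q * L * m₀ + (Q * Bl + T * F)
    expanded = trans equation (cong₂ (λ n b → n * m₀ + b) N≡QL Bn≡QBl+TF)

    -- Case X = Y + d: multiplying the equation by d and using d F + Q D = P D.
    identity-above : ∀ d → X ≡ Y + d → W * (d * mₙ) + Q * (T * D) ≡ Q * (L * d * m₀ + Bl * d) + W * D
    identity-above d X≡Y+d = begin
      W * (d * mₙ) + Q * (T * D)                           ≡⟨ regroup₁ W d mₙ (Q * (T * D)) ⟩
      d * (W * mₙ) + Q * (T * D)                           ≡⟨ cong (λ x → d * x + Q * (T * D)) expanded ⟩
      d * (Q * L * m₀ + (Q * Bl + T * F)) + Q * (T * D)    ≡⟨ regroup₂ Q L Bl T F D d m₀ ⟩
      Q * (L * d * m₀ + Bl * d) + T * (d * F + Q * D)      ≡⟨ cong (λ x → Q * (L * d * m₀ + Bl * d) + T * x) dF+QD≡PD ⟩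
      Q * (L * d * m₀ + Bl * d) + T * (P * D)              ≡⟨ cong (λ x → Q * (L * d * m₀ + Bl * d) + x) (regroup₃ T P D) ⟩
      Q * (L * d * m₀ + Bl * d) + P * T * D                ≡⟨ cong (λ w → Q * (L * d * m₀ + Bl * d) + w * D) (sym W≡PT) ⟩
      Q * (L * d * m₀ + Bl * d) + W * D                    ∎
      where
      open ≡-Reasoning
      dF+QD≡PD : d * F + Q * D ≡ P * D
      dF+QD≡PD = +-cancelˡ-≡ (Y * F) _ _ (trans (regroup₀ Y d F (Q * D)) (trans (cong (λ x → x * F + Q * D) (sym X≡Y+d)) geometric))
        where
        regroup₀ : ∀ Y d F x → Y * F + (d * F + x) ≡ (Y + d) * F + x
        regroup₀ = ℕ-Solver.solve-∀
      regroup₁ : ∀ W d m x → W * (d * m) + x ≡ d * (W * m) + x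
      regroup₁ = ℕ-Solver.solve-∀
      regroup₂ : ∀ Q L Bl T F D d m → d * (Q * L * m + (Q * Bl + T * F)) + Q * (T * D) ≡ Q * (L * d * m + Bl * d) + T * (d * F + Q * D)
      regroup₂ = ℕ-Solver.solve-∀
      regroup₃ : ∀ T P D → T * (P * D) ≡ P * T * D
      regroup₃ = ℕ-Solver.solve-∀

    -- Case Y = X + d: multiplying the equation by d and using Q D = d F + P D.
    identity-below : ∀ d → Y ≡ X + d → W * (d * mₙ + D) ≡ Q * (L * d * m₀ + Bl * d + T * D)
    identity-below d Y≡X+d = begin
      W * (d * mₙ + D)                                    ≡⟨ regroup₁ W d mₙ D ⟩
      d * (W * mₙ) + W * D                                ≡⟨ cong₂ (λ x w → d * x + w * D) expanded W≡PT ⟩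
      d * (Q * L * m₀ + (Q * Bl + T * F)) + P * T * D     ≡⟨ regroup₂ Q L Bl T F D P d m₀ ⟩
      Q * (L * d * m₀ + Bl * d) + T * (d * F + P * D)     ≡⟨ cong (λ x → Q * (L * d * m₀ + Bl * d) + T * x) (sym QD≡dF+PD) ⟩
      Q * (L * d * m₀ + Bl * d) + T * (Q * D)             ≡⟨ regroup₃ Q L Bl T D d m₀ ⟩
      Q * (L * d * m₀ + Bl * d + T * D)                   ∎
      where
      open ≡-Reasoning
      QD≡dF+PD : Q * D ≡ d * F + P * D
      QD≡dF+PD = +-cancelˡ-≡ (X * F) _ _ (trans geometric (trans (cong (λ y → y * F + P * D) Y≡X+d) (regroup₀ X d F (P * D))))
        where
        regroup₀ : ∀ X d F x → (X + d) * F + x ≡ X * F + (d * F + x)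
        regroup₀ = ℕ-Solver.solve-∀
      regroup₁ : ∀ W d m D → W * (d * m + D) ≡ d * (W * m) + W * D
      regroup₁ = ℕ-Solver.solve-∀
      regroup₂ : ∀ Q L Bl T F D P d m → d * (Q * L * m + (Q * Bl + T * F)) + P * T * D ≡ Q * (L * d * m + Bl * d) + T * (d * F + P * D)
      regroup₂ = ℕ-Solver.solve-∀
      regroup₃ : ∀ Q L Bl T D d m → Q * (L * d * m + Bl * d) + T * (Q * D) ≡ Q * (L * d * m + Bl * d + T * D)
      regroup₃ = ℕ-Solver.solve-∀

    solution-above : ∀ d → X ≡ Y + d → 1 ≤ d →
      ∃ λ u → u < d * L × d * mₙ ≡ u * Q + D × W * u + T * D ≡ L * d * m₀ + Bl * d
    solution-above d X≡Y+d 1≤d = bound (coprime-quotient-shifted Q⊥W TD<W (identity-above d X≡Y+d))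
      where
      TD<W : T * D < W
      TD<W = ≤-<-trans (*-monoʳ-≤ T (m≤n+m D (Bl * Y))) T[BlY+D]<W
      bound : (∃ λ u → d * mₙ ≡ u * Q + D × W * u + T * D ≡ L * d * m₀ + Bl * d) →
              ∃ λ u → u < d * L × d * mₙ ≡ u * Q + D × W * u + T * D ≡ L * d * m₀ + Bl * d
      bound (u , dmₙ≡uQ+D , Wu+TD≡R) = u , *-cancelʳ-< Q u (d * L) uQ<dLQ , dmₙ≡uQ+D , Wu+TD≡R
        where
        open ≤-Reasoning
        uQ<dLQ : u * Q < d * L * Q
        uQ<dLQ = begin-strict
          u * Q           ≤⟨ m≤m+n (u * Q) D ⟩
          u * Q + D       ≡⟨ sym dmₙ≡uQ+D ⟩
          d * mₙ          <⟨ *-monoʳ-< d {{>-nonZero 1≤d}} (subst (mₙ <_) N≡QL mₙ<N) ⟩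
          d * (Q * L)     ≡⟨ trans (cong (d *_) (*-comm Q L)) (sym (*-assoc d L Q)) ⟩
          d * L * Q       ∎

    solution-below : ∀ d → Y ≡ X + d → 1 ≤ d →
      ∃ λ u → 1 ≤ u × u ≤ d * L × d * mₙ + D ≡ u * Q × W * u ≡ L * d * m₀ + Bl * d + T * D
    solution-below d Y≡X+d 1≤d = bounds (coprime-quotient Q⊥W exact)
      where
      R : ℕ
      R = L * d * m₀ + Bl * d + T * D
      exact : W * (d * mₙ + D) + Q * 0 ≡ Q * R
      exact = trans (cong (λ x → W * (d * mₙ + D) + x) (*-zeroʳ Q)) (trans (+-identityʳ _) (identity-below d Y≡X+d))
      bounds : (∃ λ u → d * mₙ + D ≡ u * Q × W * u + 0 ≡ R) → ∃ λ u → 1 ≤ u × u ≤ d * L × d * mₙ + D ≡ u * Q × W * u ≡ R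
      bounds (zero  , dmₙ+D≡0 , _) = contradiction (≤-trans (*-mono-≤ 1≤d 1≤mₙ) (m≤m+n (d * mₙ) D)) (<-irrefl (sym dmₙ+D≡0))
      bounds (suc u , dmₙ+D≡uQ , Wu+0≡R) = suc u , s≤s z≤n , s≤s⁻¹ (*-cancelˡ-< W (suc u) (suc (d * L)) Wu<W[dL+1]) ,
                                           dmₙ+D≡uQ , Wu≡R
        where
        open ≤-Reasoning
        Wu≡R : W * suc u ≡ L * d * m₀ + Bl * d + T * D
        Wu≡R = trans (sym (+-identityʳ _)) Wu+0≡R
        Wu<W[dL+1] : W * suc u < W * suc (d * L)
        Wu<W[dL+1] = begin-strict
          W * suc u                           ≡⟨ Wu≡R ⟩
          L * d * m₀ + Bl * d + T * D         ≡⟨ +-assoc (L * d * m₀) (Bl * d) (T * D) ⟩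
          L * d * m₀ + (Bl * d + T * D)       <⟨ +-mono-≤-< (*-monoʳ-≤ (L * d) (<⇒≤ m₀<W)) (remainder<W (subst (d ≤_) (sym Y≡X+d) (m≤n+m d X))) ⟩
          L * d * W + W                       ≡⟨ regroup L d W ⟩
          W * suc (d * L)                     ∎
          where
          regroup : ∀ L d W → L * d * W + W ≡ W * (1 + d * L)
          regroup = ℕ-Solver.solve-∀

  case-above : ∀ (x₀ xₙ : ℤ) → + W *ℤ xₙ -ℤ + N *ℤ x₀ ≡ + Bn →
    + 1 ≤ℤ x₀ → x₀ <ℤ + W → + 1 ≤ℤ xₙ → xₙ <ℤ + N → X > Y →
    ∃ λ (u : ℤ) → + 0 ≤ℤ u × u <ℤ (+ X -ℤ + Y) *ℤ + L
      × x₀ *ℤ ((+ X -ℤ + Y) *ℤ + L) ≡ + W *ℤ u -ℤ + Bl *ℤ (+ X -ℤ + Y) +ℤ + T *ℤ + D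
      × xₙ *ℤ (+ X -ℤ + Y) ≡ + Q *ℤ u +ℤ + D
  case-above (+ m₀) (+ mₙ) eq (+≤+ _) (+<+ m₀<W) (+≤+ 1≤mₙ) (+<+ mₙ<N) Y<X rewrite positive-difference (<⇒≤ Y<X) =
    lift-above W Q T D L Bl d m₀ mₙ (solution-above d X≡Y+d (m<n⇒0<n∸m Y<X))
    where
    open Solution m₀ mₙ (from-ℤ W mₙ N m₀ Bn eq) m₀<W 1≤mₙ mₙ<N
    d : ℕ
    d = X ∸ Y
    X≡Y+d : X ≡ Y + d
    X≡Y+d = sym (m+[n∸m]≡n (<⇒≤ Y<X))

  case-below : ∀ (x₀ xₙ : ℤ) → + W *ℤ xₙ -ℤ + N *ℤ x₀ ≡ + Bn →
    + 1 ≤ℤ x₀ → x₀ <ℤ + W → + 1 ≤ℤ xₙ → xₙ <ℤ + N → Y > X →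
    ∃ λ (u : ℤ) → + 1 ≤ℤ u × u ≤ℤ (+ Y -ℤ + X) *ℤ + L
      × x₀ *ℤ ((+ Y -ℤ + X) *ℤ + L) ≡ + W *ℤ u -ℤ + Bl *ℤ (+ Y -ℤ + X) -ℤ + T *ℤ + D
      × xₙ *ℤ (+ Y -ℤ + X) ≡ + Q *ℤ u -ℤ + D
  case-below (+ m₀) (+ mₙ) eq (+≤+ _) (+<+ m₀<W) (+≤+ 1≤mₙ) (+<+ mₙ<N) X<Y rewrite positive-difference (<⇒≤ X<Y) =
    lift-below W Q T D L Bl d m₀ mₙ (solution-below d Y≡X+d (m<n⇒0<n∸m X<Y))
    where
    open Solution m₀ mₙ (from-ℤ W mₙ N m₀ Bn eq) m₀<W 1≤mₙ mₙ<N
    d : ℕ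
    d = Y ∸ X
    Y≡X+d : Y ≡ X + d
    Y≡X+d = sym (m+[n∸m]≡n (<⇒≤ X<Y))

n<2^n : ∀ n → n < 2 ^ n
n<2^n zero    = s≤s z≤n
n<2^n (suc n) = +-mono-≤-< (m^n>0 2 n) (≤-trans (n<2^n n) (m≤m+n (2 ^ n) 0))

proposition3p3 :
    (a : ℕ → ℕ) (l r : ℕ) → 1 ≤ r →
    (∀ n → 1 ≤ n → 1 ≤ a n) →
    (∀ n → n > l → a n ≡ a (n + r)) →
    ∃ λ (K : ℕ) → ∀ (k : ℕ) → k > K → 1 ≤ r * k + l →
      ∀ (x₀ xₙ : ℤ) →
      (+ (2 ^ (sPer a l r * k + b a l))) *ℤ xₙ -ℤ (+ (3 ^ (r * k + l))) *ℤ x₀ ≡ + (B a (r * k + l)) →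
      + 1 ≤ℤ x₀ → x₀ <ℤ + (2 ^ (sPer a l r * k + b a l)) →
      + 1 ≤ℤ xₙ → xₙ <ℤ + (3 ^ (r * k + l)) →
      (2 ^ sPer a l r > 3 ^ r →
        ∃ λ (u : ℤ) → + 0 ≤ℤ u × u <ℤ ((+ (2 ^ sPer a l r) -ℤ + (3 ^ r)) *ℤ + (3 ^ l))
          × x₀ *ℤ ((+ (2 ^ sPer a l r) -ℤ + (3 ^ r)) *ℤ + (3 ^ l))
              ≡ (+ (2 ^ (sPer a l r * k + b a l))) *ℤ u
                -ℤ (+ (B a l)) *ℤ (+ (2 ^ sPer a l r) -ℤ + (3 ^ r))
                +ℤ (+ (2 ^ b a l)) *ℤ (+ (Dconst a l r))
          × xₙ *ℤ (+ (2 ^ sPer a l r) -ℤ + (3 ^ r))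
              ≡ (+ (3 ^ (r * k))) *ℤ u +ℤ + (Dconst a l r))
      × (3 ^ r > 2 ^ sPer a l r →
        ∃ λ (u : ℤ) → + 1 ≤ℤ u × u ≤ℤ ((+ (3 ^ r) -ℤ + (2 ^ sPer a l r)) *ℤ + (3 ^ l))
          × x₀ *ℤ ((+ (3 ^ r) -ℤ + (2 ^ sPer a l r)) *ℤ + (3 ^ l))
              ≡ (+ (2 ^ (sPer a l r * k + b a l))) *ℤ u
                -ℤ (+ (B a l)) *ℤ (+ (3 ^ r) -ℤ + (2 ^ sPer a l r))
                -ℤ (+ (2 ^ b a l)) *ℤ (+ (Dconst a l r))
          × xₙ *ℤ (+ (3 ^ r) -ℤ + (2 ^ sPer a l r))
              ≡ (+ (3 ^ (r * k))) *ℤ u -ℤ + (Dconst a l r))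
proposition3p3 a l r 1≤r pos per = K , λ k k>K _ x₀ xₙ eq 1≤x₀ x₀<W 1≤xₙ xₙ<N →
  let open Core (2 ^ (s * k + b a l)) (3 ^ (r * k + l)) (B a (r * k + l)) (2 ^ (s * k)) (2 ^ b a l)
                (3 ^ (r * k)) (3 ^ l) (B a l) (Dconst a l r) (E (r * k)) (2 ^ s) (3 ^ r)
                (^-distribˡ-+-* 2 (s * k) (b a l)) (^-distribˡ-+-* 3 (r * k) l) (B-at k) (geometric k)
                (coprime-3^-2^ (r * k) (s * k + b a l)) {{m^n≢0 2 (b a l)}} {{m^n≢0 3 (r * k)}} (large k k>K)
  in case-above x₀ xₙ eq 1≤x₀ x₀<W 1≤xₙ xₙ<N , case-below x₀ xₙ eq 1≤x₀ x₀<W 1≤xₙ xₙ<N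
  where
  open Sequence a l
  open Periodic r per
  s : ℕ
  s = sPer a l r
  K : ℕ
  K = B a l * 3 ^ r + Dconst a l r
  B-at : ∀ k → B a (r * k + l) ≡ 3 ^ (r * k) * B a l + 2 ^ b a l * E (r * k)
  B-at k = trans (cong (B a) (+-comm (r * k) l)) (B-shift (r * k))
  geometric : ∀ k → 2 ^ s * E (r * k) + 3 ^ (r * k) * Dconst a l r ≡ 3 ^ r * E (r * k) + 2 ^ (s * k) * Dconst a l r
  geometric k = subst₂ (λ s D → 2 ^ s * E (r * k) + 3 ^ (r * k) * D ≡ 3 ^ r * E (r * k) + 2 ^ (s * k) * D)
                       (sym (sPer≡c r)) (sym (Dconst≡E r 1≤r)) (E-geometric k)
  -- for k > K: K < k < 2^k ≤ 2^{sk}, since s ≥ 1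
  large : ∀ k → k > K → B a l * 3 ^ r + Dconst a l r < 2 ^ (s * k)
  large k k>K = <-trans k>K (<-≤-trans (n<2^n k) (^-monoʳ-≤ 2 (m≤n*m k s {{>-nonZero 1≤s}})))
    where
    1≤s : 1 ≤ s
    1≤s = subst (1 ≤_) (sym (sPer≡c r)) (c-positive pos r 1≤r)
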